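{- Let $\mathbb{P}=(R,G)$ and $\mathbb{P}'=(R',G')$ be partial fields and let $\phi:\mathbb{P}\to\mathbb{P}'$ be a strong partial-field homomorphism. Then there is a unique strong partial-field homomorphism $\psi:\mathbb{DP}\to\mathbb{P}'$ such that $\psi\circ i=\phi$, where $i:\mathbb{P}\to\mathbb{DP}$ is the canonical inclusion $i(p)=[X_p]$ (and $i(0)=0$).
   Context: A partial field is a pair $(R,G)$ with $R$ a commutative ring with unity and $G$ a subgroup of $R^\times$ with $-1\in G$; its elements are $0$ and the elements of $G$. A strong partial-field homomorphism $(R_1,G_1)\to(R_2,G_2)$ is a ring homomorphism $R_1\to R_2$ mapping $G_1$ into $G_2$. Fundamental elements: $\mathcal{F}(\mathbb{P})=\{p\in\mathbb{P}:1-p\in\mathbb{P}\}$. Dowling lift: let $\overline{G}=\{X_p:p\in G\}$ be an isomorphic copy of $G$, $\overline{Q}_{\mathbb{P}}=\{Y_p: p\in\mathcal{F}(\mathbb{P})\setminus\{0,1\}\}$ indeterminates, $D_{\mathbb{P}}=\mathbb{Z}[\overline{G}][\overline{Q}_{\mathbb{P}}]$ (polynomial ring over the group ring), $J_{\mathbb{P}}$ the ideal generated by $X_1-1$ and $Y_p(1-X_p)-1$ for $p\in\mathcal{F}(\mathbb{P})\setminus\{0,1\}$; then $\mathbb{DP}=(D_{\mathbb{P}}/J_{\mathbb{P}},\langle\{ -1\}\cup\overline{G}\cup\overline{Q}_{\mathbb{P}}\rangle)$. -}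

module Defs where

open import Level using (Level; _⊔_; suc)
open import Data.Product using (Σ; _×_; _,_; proj₁; proj₂)
open import Data.Sum using (_⊎_; inj₁; inj₂)
open import Data.Empty using (⊥-elim)
open import Relation.Nullary using (¬_)
open import Algebra.Bundles using (CommutativeRing)
open import Algebra.Structures using (IsCommutativeRing)
open import Algebra.Morphism.Structures using (IsRingHomomorphism)

record PartialField (c ℓ : Level) : Set (suc (c ⊔ ℓ)) where
  field
    cring : CommutativeRing c ℓ
  open CommutativeRing cring public
  field
    G         : Carrier → Set ℓ
    G-resp    : ∀ {x y} → x ≈ y → G x → G y
    G-one     : G 1#
    G-mul     : ∀ {x y} → G x → G y → G (x * y)
    G-inv     : ∀ {x} → G x → Σ Carrier (λ y → G y × (x * y) ≈ 1#)
    G-neg-one : G (- 1#)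

  InP : Carrier → Set ℓ
  InP x = x ≈ 0# ⊎ G x

  Elements : Set (c ⊔ ℓ)
  Elements = Σ Carrier InP

  Fundamental : Carrier → Set ℓ
  Fundamental p = InP p × InP (1# - p)

IsStrongHom : ∀ {c₁ ℓ₁ c₂ ℓ₂} (P₁ : PartialField c₁ ℓ₁) (P₂ : PartialField c₂ ℓ₂) →
              (PartialField.Carrier P₁ → PartialField.Carrier P₂) → Set (c₁ ⊔ ℓ₁ ⊔ ℓ₂)
IsStrongHom P₁ P₂ f =
  IsRingHomomorphism (PartialField.rawRing P₁) (PartialField.rawRing P₂) f
  × (∀ x → PartialField.G P₁ x → PartialField.G P₂ (f x))

-- D_P / J_P = Z[Ḡ][Q̄_P] / J_P is built (no quotient types in Agda) as a
-- setoid: the ring of terms in the generators X_p (p ∈ G) and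
-- Y_p (p ∈ F(P) \ {0,1}), modulo the congruence generated by the
-- commutative-ring axioms, the group-ring relations X_p X_q = X_{pq}
-- (which, together with X_1 = 1, present Z[Ḡ] as a quotient of the
-- polynomial ring on the symbols X_p), the generator X_1 - 1 of J_P, and
-- the generators Y_p (1 - X_p) - 1 of J_P.

module Dowling {c ℓ : Level} (P : PartialField c ℓ) where
  open PartialField P using (Carrier; _≈_; _*_; 0#; 1#; G; G-mul; G-inv; Fundamental; Elements; refl)

  GElt : Set (c ⊔ ℓ)
  GElt = Σ Carrier G

  QElt : Set (c ⊔ ℓ)
  QElt = Σ Carrier (λ p → Fundamental p × ¬ (p ≈ 0#) × ¬ (p ≈ 1#))

  QElt→G : (q : QElt) → G (proj₁ q)
  QElt→G (p , (inj₁ p≈0 , _) , p≉0 , _) = ⊥-elim (p≉0 p≈0)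
  QElt→G (p , (inj₂ g , _) , _ , _) = g

  QElt→GElt : QElt → GElt
  QElt→GElt q = proj₁ q , QElt→G q

  infixl 7 _⊗_
  infixl 6 _⊕_
  infix 4 _∼_

  data Term : Set (c ⊔ ℓ) where
    X    : GElt → Term
    Y    : QElt → Term
    tzero : Term
    tone  : Term
    _⊕_  : Term → Term → Term
    _⊗_  : Term → Term → Term
    ⊖_   : Term → Term

  data _∼_ : Term → Term → Set (c ⊔ ℓ) where
    ∼-refl  : ∀ {a} → a ∼ a
    ∼-sym   : ∀ {a b} → a ∼ b → b ∼ a
    ∼-trans : ∀ {a b d} → a ∼ b → b ∼ d → a ∼ d
    ⊕-cong  : ∀ {a a′ b b′} → a ∼ a′ → b ∼ b′ → a ⊕ b ∼ a′ ⊕ b′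
    ⊗-cong  : ∀ {a a′ b b′} → a ∼ a′ → b ∼ b′ → a ⊗ b ∼ a′ ⊗ b′
    ⊖-cong  : ∀ {a a′} → a ∼ a′ → ⊖ a ∼ ⊖ a′
    ⊕-assoc : ∀ a b d → (a ⊕ b) ⊕ d ∼ a ⊕ (b ⊕ d)
    ⊕-comm  : ∀ a b → a ⊕ b ∼ b ⊕ a
    ⊕-idˡ   : ∀ a → tzero ⊕ a ∼ a
    ⊖-invˡ  : ∀ a → (⊖ a) ⊕ a ∼ tzero
    ⊗-assoc : ∀ a b d → (a ⊗ b) ⊗ d ∼ a ⊗ (b ⊗ d)
    ⊗-comm  : ∀ a b → a ⊗ b ∼ b ⊗ a
    ⊗-idˡ   : ∀ a → tone ⊗ a ∼ a
    distribʳ : ∀ a b d → (b ⊕ d) ⊗ a ∼ (b ⊗ a) ⊕ (d ⊗ a)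
    X-mul   : ∀ (g h k : GElt) → proj₁ k ≈ proj₁ g * proj₁ h → X g ⊗ X h ∼ X k
    X-tone   : ∀ (k : GElt) → proj₁ k ≈ 1# → X k ∼ tone
    Y-rel   : ∀ (q : QElt) → Y q ⊗ (tone ⊕ ⊖ X (QElt→GElt q)) ∼ tone

  private
    ⊕-idʳ : ∀ a → a ⊕ tzero ∼ a
    ⊕-idʳ a = ∼-trans (⊕-comm a tzero) (⊕-idˡ a)
    ⊖-invʳ : ∀ a → a ⊕ (⊖ a) ∼ tzero
    ⊖-invʳ a = ∼-trans (⊕-comm a (⊖ a)) (⊖-invˡ a)
    ⊗-idʳ : ∀ a → a ⊗ tone ∼ a
    ⊗-idʳ a = ∼-trans (⊗-comm a tone) (⊗-idˡ a)
    distribˡ : ∀ a b d → a ⊗ (b ⊕ d) ∼ (a ⊗ b) ⊕ (a ⊗ d)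
    distribˡ a b d =
      ∼-trans (⊗-comm a (b ⊕ d))
        (∼-trans (distribʳ a b d) (⊕-cong (⊗-comm b a) (⊗-comm d a)))

  isCommutativeRing : IsCommutativeRing _∼_ _⊕_ _⊗_ ⊖_ tzero tone
  isCommutativeRing = record
    { isRing = record
      { +-isAbelianGroup = record
        { isGroup = record
          { isMonoid = record
            { isSemigroup = record
              { isMagma = record
                { isEquivalence = record { refl = ∼-refl ; sym = ∼-sym ; trans = ∼-trans }
                ; ∙-cong = ⊕-cong }
              ; assoc = ⊕-assoc }
            ; identity = ⊕-idˡ , ⊕-idʳ }
          ; inverse = ⊖-invˡ , ⊖-invʳ
          ; ⁻¹-cong = ⊖-cong }
        ; comm = ⊕-comm }
      ; *-cong = ⊗-cong
      ; *-assoc = ⊗-assoc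
      ; *-identity = ⊗-idˡ , ⊗-idʳ
      ; distrib = distribˡ , distribʳ }
    ; *-comm = ⊗-comm }

  DRing : CommutativeRing (c ⊔ ℓ) (c ⊔ ℓ)
  DRing = record { isCommutativeRing = isCommutativeRing }

  -- the subgroup ⟨ {-1} ∪ Ḡ ∪ Q̄_P ⟩ of the unit group, as the smallest
  -- subset containing the generators and 1, closed under products,
  -- under taking inverses, and under ∼.
  data InGen : Term → Set (c ⊔ ℓ) where
    gen-neg-tone : InGen (⊖ tone)
    gen-X       : ∀ g → InGen (X g)
    gen-Y       : ∀ q → InGen (Y q)
    gen-tone     : InGen tone
    gen-mul     : ∀ {a b} → InGen a → InGen b → InGen (a ⊗ b)
    gen-inv     : ∀ {a b} → InGen a → a ⊗ b ∼ tone → InGen b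
    gen-resp    : ∀ {a b} → a ∼ b → InGen a → InGen b

  private
    invX : GElt → GElt
    invX (g , pg) = proj₁ (G-inv pg) , proj₁ (proj₂ (G-inv pg))

    units : ∀ {a} → InGen a → Σ Term (λ b → InGen b × a ⊗ b ∼ tone)
    units gen-neg-tone = ⊖ tone , gen-neg-tone , neg-sq
      where
      open import Algebra.Properties.Ring (CommutativeRing.ring DRing) using (-1*x≈-x; -‿involutive)
      neg-sq : (⊖ tone) ⊗ (⊖ tone) ∼ tone
      neg-sq = ∼-trans (-1*x≈-x (⊖ tone)) (-‿involutive tone)
    units (gen-X g) = X (invX g) , gen-X (invX g) ,
      ∼-trans (X-mul g (invX g) (proj₁ g * proj₁ (invX g) , G-mul (proj₂ g) (proj₂ (invX g))) refl)
              (X-tone _ (proj₂ (proj₂ (G-inv (proj₂ g)))))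
    units (gen-Y q) = tone ⊕ ⊖ X (QElt→GElt q) , gen-inv (gen-Y q) (Y-rel q) , Y-rel q
    units gen-tone = tone , gen-tone , ⊗-idˡ tone
    units (gen-mul {a} {b} ia ib) with units ia | units ib
    ... | a′ , ia′ , e₁ | b′ , ib′ , e₂ = a′ ⊗ b′ , gen-mul ia′ ib′ ,
      ∼-trans (⊗-assoc a b (a′ ⊗ b′))
      (∼-trans (⊗-cong ∼-refl (∼-trans (∼-sym (⊗-assoc b a′ b′))
                 (∼-trans (⊗-cong (⊗-comm b a′) ∼-refl) (⊗-assoc a′ b b′))))
      (∼-trans (∼-sym (⊗-assoc a a′ (b ⊗ b′)))
      (∼-trans (⊗-cong e₁ e₂) (⊗-idˡ tone))))
    units (gen-inv {a} {b} ia e) = a , ia , ∼-trans (⊗-comm b a) e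
    units (gen-resp {a} {b} e ia) with units ia
    ... | a′ , ia′ , e′ = a′ , ia′ , ∼-trans (⊗-cong (∼-sym e) ∼-refl) e′

  DP : PartialField (c ⊔ ℓ) (c ⊔ ℓ)
  DP = record
    { cring = DRing
    ; G = InGen
    ; G-resp = gen-resp
    ; G-one = gen-tone
    ; G-mul = gen-mul
    ; G-inv = units
    ; G-neg-one = gen-neg-tone
    }

  incl : Elements → Term
  incl (x , inj₁ _) = tzero
  incl (x , inj₂ g) = X (x , g)

open Dowling public using (DP; incl)

{-# OPTIONS --safe #-}
-- DP is presented by generators X_p, Y_q and relations, so a ring homomorphism out of it is
-- an assignment of the generators respecting the relations.  X_p ↦ φ p and
-- Y_q ↦ φ (1 - q)⁻¹ is one: 1 - q lies in G for a fundamental q ≠ 0, 1, hence φ (1 - q) is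
-- invertible in G′.  It is forced, since X_p ↦ φ p is the condition ψ ∘ i = φ and Y_q is
-- the inverse of 1 - X_q, which any ring homomorphism sends to the unique inverse of
-- 1 - φ q.  Finally the images of -1, X_p, Y_q lie in the group G′, hence so does the
-- image of the subgroup they generate.
module Submission where

open import Defs
open import Function using (_∘_)
open import Data.Product using (Σ; _×_; proj₁; proj₂; _,_)
open import Data.Sum using (inj₁; inj₂)
open import Data.Empty using (⊥-elim)
open import Algebra.Bundles using (CommutativeMonoid; CommutativeRing)
open import Algebra.Bundles.Raw using (RawRing)
open import Algebra.Morphism.Structures using (IsRingHomomorphism)
import Algebra.Properties.Ring as RingProperties
import Relation.Binary.Reasoning.Setoid as SetoidReasoning

module _ {a ℓ} (M : CommutativeMonoid a ℓ) where
  open CommutativeMonoid M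
  open SetoidReasoning setoid

  inverse-unique : ∀ {x y z} → x ∙ y ≈ ε → x ∙ z ≈ ε → y ≈ z
  inverse-unique {x} {y} {z} xy≈ε xz≈ε = begin
    y            ≈⟨ identityʳ y ⟨
    y ∙ ε        ≈⟨ ∙-congˡ xz≈ε ⟨
    y ∙ (x ∙ z)  ≈⟨ assoc y x z ⟨
    (y ∙ x) ∙ z  ≈⟨ ∙-congʳ (comm y x) ⟩
    (x ∙ y) ∙ z  ≈⟨ ∙-congʳ xy≈ε ⟩
    ε ∙ z        ≈⟨ identityˡ z ⟩
    z            ∎

module RingHomomorphismInto {b ℓb} (S : CommutativeRing b ℓb) where
  open CommutativeRing S

  module _ {a ℓa} {R : RawRing a ℓa} {f : RawRing.Carrier R → Carrier}
           (f-hom : IsRingHomomorphism R rawRing f) where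
    private
      module R = RawRing R
    open IsRingHomomorphism f-hom

    homo-1-minus : ∀ x → f (R.1# R.+ R.- x) ≈ 1# - f x
    homo-1-minus x = trans (+-homo R.1# (R.- x)) (+-cong 1#-homo (-‿homo x))

    homo-inverse : ∀ {x y} → x R.* y R.≈ R.1# → f x * f y ≈ 1#
    homo-inverse {x} {y} xy≈1 = trans (sym (*-homo x y)) (trans (⟦⟧-cong xy≈1) 1#-homo)

module _ {c ℓ} (P : PartialField c ℓ) where
  open PartialField P
  open Dowling P using (QElt)
  open RingProperties ring using (x∙y⁻¹≈ε⇒x≈y)

  1-p∈G : (q : QElt) → G (1# - proj₁ q)
  1-p∈G (p , (_ , inj₁ 1-p≈0) , _ , p≉1) = ⊥-elim (p≉1 (sym (x∙y⁻¹≈ε⇒x≈y 1# p 1-p≈0)))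
  1-p∈G (p , (_ , inj₂ 1-p∈G) , _ , _) = 1-p∈G

module _ {c ℓ c′ ℓ′} (P : PartialField c ℓ) (S : CommutativeRing c′ ℓ′) where
  open Dowling P
  open CommutativeRing S
  open RingHomomorphismInto S

  X-determines-homomorphism : ∀ {f g : Term → Carrier} →
    IsRingHomomorphism (CommutativeRing.rawRing DRing) rawRing f →
    IsRingHomomorphism (CommutativeRing.rawRing DRing) rawRing g →
    (∀ k → f (X k) ≈ g (X k)) → ∀ t → f t ≈ g t
  X-determines-homomorphism {f} {g} f-hom g-hom f≈g = go
    where
    module F = IsRingHomomorphism f-hom
    module G = IsRingHomomorphism g-hom

    go : ∀ t → f t ≈ g t
    go (X k) = f≈g k
    go (Y q) = inverse-unique *-commutativeMonoid
      (trans (*-comm _ _) (homo-inverse f-hom (Y-rel q)))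
      (trans (*-congʳ f[1-X]≈g[1-X]) (trans (*-comm _ _) (homo-inverse g-hom (Y-rel q))))
      where
      k = QElt→GElt q
      f[1-X]≈g[1-X] : f (tone ⊕ ⊖ X k) ≈ g (tone ⊕ ⊖ X k)
      f[1-X]≈g[1-X] = trans (homo-1-minus f-hom (X k))
        (trans (+-congˡ (-‿cong (f≈g k))) (sym (homo-1-minus g-hom (X k))))
    go tzero = trans F.0#-homo (sym G.0#-homo)
    go tone = trans F.1#-homo (sym G.1#-homo)
    go (t ⊕ u) = trans (F.+-homo t u) (trans (+-cong (go t) (go u)) (sym (G.+-homo t u)))
    go (t ⊗ u) = trans (F.*-homo t u) (trans (*-cong (go t) (go u)) (sym (G.*-homo t u)))
    go (⊖ t) = trans (F.-‿homo t) (trans (-‿cong (go t)) (sym (G.-‿homo t)))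

module _ {c ℓ c′ ℓ′} (P : PartialField c ℓ) (P′ : PartialField c′ ℓ′) where
  open Dowling P using (GElt; QElt; QElt→GElt)
  private
    module P = PartialField P
  open PartialField P′

  module Evaluation (x : GElt → Carrier) (y : QElt → Carrier)
    (x-mul : ∀ g h k → proj₁ k P.≈ proj₁ g P.* proj₁ h → x g * x h ≈ x k)
    (x-one : ∀ k → proj₁ k P.≈ P.1# → x k ≈ 1#)
    (y-inverse : ∀ q → y q * (1# - x (QElt→GElt q)) ≈ 1#) where

    open Dowling P hiding (GElt; QElt; QElt→GElt; DP; incl) renaming (distribʳ to ∼-distribʳ)

    eval : Term → Carrier
    eval (X k) = x k
    eval (Y q) = y q
    eval tzero = 0#
    eval tone = 1#
    eval (t ⊕ u) = eval t + eval u
    eval (t ⊗ u) = eval t * eval u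
    eval (⊖ t) = - eval t

    eval-cong : ∀ {t u} → t ∼ u → eval t ≈ eval u
    eval-cong ∼-refl = refl
    eval-cong (∼-sym e) = sym (eval-cong e)
    eval-cong (∼-trans e f) = trans (eval-cong e) (eval-cong f)
    eval-cong (⊕-cong e f) = +-cong (eval-cong e) (eval-cong f)
    eval-cong (⊗-cong e f) = *-cong (eval-cong e) (eval-cong f)
    eval-cong (⊖-cong e) = -‿cong (eval-cong e)
    eval-cong (⊕-assoc _ _ _) = +-assoc _ _ _
    eval-cong (⊕-comm _ _) = +-comm _ _
    eval-cong (⊕-idˡ _) = +-identityˡ _
    eval-cong (⊖-invˡ _) = -‿inverseˡ _
    eval-cong (⊗-assoc _ _ _) = *-assoc _ _ _
    eval-cong (⊗-comm _ _) = *-comm _ _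
    eval-cong (⊗-idˡ _) = *-identityˡ _
    eval-cong (∼-distribʳ _ _ _) = distribʳ _ _ _
    eval-cong (X-mul g h k e) = x-mul g h k e
    eval-cong (X-tone k e) = x-one k e
    eval-cong (Y-rel q) = y-inverse q

    eval-isRingHomomorphism : IsRingHomomorphism (CommutativeRing.rawRing DRing) rawRing eval
    eval-isRingHomomorphism = record
      { isSemiringHomomorphism = record
        { isNearSemiringHomomorphism = record
          { +-isMonoidHomomorphism = record
            { isMagmaHomomorphism = record
              { isRelHomomorphism = record { cong = eval-cong }
              ; homo = λ _ _ → refl }
            ; ε-homo = refl }
          ; *-homo = λ _ _ → refl }
        ; 1#-homo = refl }
      ; -‿homo = λ _ → refl }

    module _ (x∈G : ∀ k → G (x k)) (y∈G : ∀ q → G (y q)) where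

      eval-G : ∀ {t} → InGen t → G (eval t)
      eval-G gen-neg-tone = G-neg-one
      eval-G (gen-X k) = x∈G k
      eval-G (gen-Y q) = y∈G q
      eval-G gen-tone = G-one
      eval-G (gen-mul t∈G u∈G) = G-mul (eval-G t∈G) (eval-G u∈G)
      eval-G (gen-inv t∈G tu≈1) with G-inv (eval-G t∈G)
      ... | v , v∈G , tv≈1 = G-resp (inverse-unique *-commutativeMonoid tv≈1 (eval-cong tu≈1)) v∈G
      eval-G (gen-resp t≈u t∈G) = G-resp (eval-cong t≈u) (eval-G t∈G)

      eval-isStrongHom : IsStrongHom (DP P) P′ eval
      eval-isStrongHom = eval-isRingHomomorphism , λ _ → eval-G

module Lift {c ℓ c′ ℓ′} (P : PartialField c ℓ) (P′ : PartialField c′ ℓ′)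
  (φ : PartialField.Carrier P → PartialField.Carrier P′) (φ-strong : IsStrongHom P P′ φ) where

  open Dowling P using (Term; GElt; QElt)
  private
    module P = PartialField P
  open PartialField P′

  φ-ring : IsRingHomomorphism P.rawRing rawRing φ
  φ-ring = proj₁ φ-strong

  φ-G : ∀ x → P.G x → G (φ x)
  φ-G = proj₂ φ-strong

  open IsRingHomomorphism φ-ring
  open RingHomomorphismInto cring

  φ[1-p]⁻¹ : (q : QElt) → Σ Carrier λ v → G v × φ (P.1# P.- proj₁ q) * v ≈ 1#
  φ[1-p]⁻¹ q = G-inv (φ-G _ (1-p∈G P q))

  φ-X-mul : ∀ (g h k : GElt) → proj₁ k P.≈ proj₁ g P.* proj₁ h → φ (proj₁ g) * φ (proj₁ h) ≈ φ (proj₁ k)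
  φ-X-mul _ _ _ k≈gh = sym (trans (⟦⟧-cong k≈gh) (*-homo _ _))

  φ-X-one : ∀ (k : GElt) → proj₁ k P.≈ P.1# → φ (proj₁ k) ≈ 1#
  φ-X-one _ k≈1 = trans (⟦⟧-cong k≈1) 1#-homo

  φ[1-p]⁻¹-inverse : ∀ q → proj₁ (φ[1-p]⁻¹ q) * (1# - φ (proj₁ q)) ≈ 1#
  φ[1-p]⁻¹-inverse q = trans (*-comm _ _)
    (trans (*-congʳ (sym (homo-1-minus φ-ring (proj₁ q)))) (proj₂ (proj₂ (φ[1-p]⁻¹ q))))

  open Evaluation P P′ (φ ∘ proj₁) (proj₁ ∘ φ[1-p]⁻¹) φ-X-mul φ-X-one φ[1-p]⁻¹-inverse public

  lift-isStrongHom : IsStrongHom (DP P) P′ eval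
  lift-isStrongHom = eval-isStrongHom (φ-G _ ∘ proj₂) (proj₁ ∘ proj₂ ∘ φ[1-p]⁻¹)

  lift-incl : ∀ e → eval (incl P e) ≈ φ (proj₁ e)
  lift-incl (_ , inj₁ e≈0) = sym (trans (⟦⟧-cong e≈0) 0#-homo)
  lift-incl (_ , inj₂ _) = refl

  lift-unique : ∀ (ψ : Term → Carrier) → IsStrongHom (DP P) P′ ψ →
    (∀ e → ψ (incl P e) ≈ φ (proj₁ e)) → ∀ t → ψ t ≈ eval t
  lift-unique ψ (ψ-ring , _) ψ-incl = X-determines-homomorphism P cring ψ-ring eval-isRingHomomorphism
    (λ k → ψ-incl (proj₁ k , inj₂ (proj₂ k)))

proposition4p7 : ∀ {c ℓ c′ ℓ′} (P : PartialField c ℓ) (P′ : PartialField c′ ℓ′)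
    (φ : PartialField.Carrier P → PartialField.Carrier P′) →
    IsStrongHom P P′ φ →
    Σ (PartialField.Carrier (DP P) → PartialField.Carrier P′) (λ ψ →
      (IsStrongHom (DP P) P′ ψ
        × (∀ (e : PartialField.Elements P) →
             PartialField._≈_ P′ (ψ (incl P e)) (φ (proj₁ e))))
      × (∀ (ψ′ : PartialField.Carrier (DP P) → PartialField.Carrier P′) →
           IsStrongHom (DP P) P′ ψ′ →
           (∀ (e : PartialField.Elements P) →
              PartialField._≈_ P′ (ψ′ (incl P e)) (φ (proj₁ e))) →
           ∀ x → PartialField._≈_ P′ (ψ′ x) (ψ x)))
proposition4p7 P P′ φ φ-strong = eval , (lift-isStrongHom , lift-incl) , lift-unique
  where open Lift P P′ φ φ-strong
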